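{- For every integer $m\ge1$, \[ \sum_{i=1}^{m}\frac{F_iF_{i+1}}{L_iL_{i+1}}=\frac{(m+1)L_{m+1}-F_{m+1}}{5L_{m+1}}. \]
   Context: $F_p$ are the Fibonacci numbers ($F_0=0,F_1=1,F_{p+1}=F_p+F_{p-1}$) and $L_p=F_{p-1}+F_{p+1}$ the Lucas numbers. -}

module Defs where

open import Data.Nat using (ℕ; zero; suc; _+_; _*_; NonZero; nonZero)
open import Data.Nat.Properties using (m*n≢0)
open import Data.Integer using (ℤ; +_; _-_)
open import Data.Rational using (ℚ; _/_; 0ℚ) renaming (_+_ to _+ℚ_)

F : ℕ → ℕ
F zero = 0
F (suc zero) = 1
F (suc (suc p)) = F (suc p) + F p

-- Lucas numbers, L p = F (p-1) + F (p+1); for p = 0 this uses F(-1) = 1,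
-- giving the standard L 0 = 2.  We define L by the same recurrence.
L : ℕ → ℕ
L zero = 2
L (suc zero) = 1
L (suc (suc p)) = L (suc p) + L p

L-nonZero : ∀ p → NonZero (L p)
L-nonZero zero = _
L-nonZero (suc zero) = _
L-nonZero (suc (suc p)) with L (suc p) | L-nonZero (suc p)
... | suc k | _ = _

L*L-nonZero : ∀ i → NonZero (L i * L (suc i))
L*L-nonZero i = m*n≢0 (L i) (L (suc i)) {{L-nonZero i}} {{L-nonZero (suc i)}}

5*L-nonZero : ∀ i → NonZero (5 * L i)
5*L-nonZero i = m*n≢0 5 (L i) {{_}} {{L-nonZero i}}

term : ℕ → ℚ
term i = _/_ (+ (F i * F (suc i))) (L i * L (suc i)) {{L*L-nonZero i}}

sumTo : ℕ → ℚ
sumTo zero = 0ℚ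
sumTo (suc m) = sumTo m +ℚ term (suc m)

rhs : ℕ → ℚ
rhs m = _/_ (+ ((m + 1) * L (m + 1)) - + F (m + 1)) (5 * L (m + 1)) {{5*L-nonZero (m + 1)}}

module Submission where

-- Telescoping: with G n = (n L_n - F_n) / (5 L_n) one has
-- G (n+1) - G n = F_n F_{n+1} / (L_n L_{n+1}) and G 1 = 0.  Writing
-- L_n = 2 F_{n-1} + F_n and L_{n+1} = 2 F_n + F_{n+1}, the difference identity
-- becomes, after clearing denominators, a polynomial identity in n, F_{n-1}, F_n.

open import Defs
open import Data.Nat using (ℕ; _≥_)
open import Relation.Binary.PropositionalEquality using (_≡_)

open import Data.Nat using (zero; suc; _+_; _*_; NonZero)
open import Data.Nat.Properties using (+-comm)
open import Data.Integer as ℤ using (ℤ; +_)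
open import Data.Integer.Properties using (pos-*; pos-+)
open import Data.Integer.Tactic.RingSolver using (solve-∀)
open import Data.Nat.Tactic.RingSolver using () renaming (solve-∀ to ℕ-solve-∀)
open import Data.Rational as ℚ using (ℚ; fromℚᵘ; toℚᵘ)
open import Data.Rational.Properties using (toℚᵘ-injective; toℚᵘ-homo-+; toℚᵘ-fromℚᵘ; /-cong)
import Data.Rational.Unnormalised as ℚᵘ
import Data.Rational.Unnormalised.Properties as ℚᵘ
open import Relation.Binary.PropositionalEquality using (refl; sym; trans; cong; cong₂; module ≡-Reasoning)

L-suc : ∀ n → L (suc n) ≡ 2 * F n + F (suc n)
L-suc zero = refl
L-suc (suc zero) = refl
L-suc (suc (suc n)) rewrite L-suc (suc n) | L-suc n = regroup (F n) (F (suc n))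
  where
  regroup : ∀ a b → (2 * b + (b + a)) + (2 * a + b) ≡ 2 * (b + a) + ((b + a) + b)
  regroup = ℕ-solve-∀

p/q+r/s≡v/t : ∀ p q r s v t .{{_ : NonZero q}} .{{_ : NonZero s}} .{{_ : NonZero t}} →
              (p ℤ.* + s ℤ.+ r ℤ.* + q) ℤ.* + t ≡ v ℤ.* + (q * s) →
              p ℚ./ q ℚ.+ r ℚ./ s ≡ v ℚ./ t
p/q+r/s≡v/t p (suc q-1) r (suc s-1) v (suc t-1) cross = toℚᵘ-injective (begin
  toℚᵘ (fromℚᵘ a ℚ.+ fromℚᵘ b)         ≈⟨ toℚᵘ-homo-+ (fromℚᵘ a) (fromℚᵘ b) ⟩
  toℚᵘ (fromℚᵘ a) ℚᵘ.+ toℚᵘ (fromℚᵘ b)  ≈⟨ ℚᵘ.+-cong (toℚᵘ-fromℚᵘ a) (toℚᵘ-fromℚᵘ b) ⟩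
  a ℚᵘ.+ b                              ≈⟨ ℚᵘ.*≡* cross ⟩
  c                                     ≈⟨ ℚᵘ.≃-sym (toℚᵘ-fromℚᵘ c) ⟩
  toℚᵘ (fromℚᵘ c)                       ∎)
  where
  open ℚᵘ.≃-Reasoning
  a b c : ℚᵘ.ℚᵘ
  a = ℚᵘ.mkℚᵘ p q-1
  b = ℚᵘ.mkℚᵘ r s-1
  c = ℚᵘ.mkℚᵘ v t-1

L-suc-ℤ : ∀ n → + L (suc n) ≡ + 2 ℤ.* + F n ℤ.+ + F (suc n)
L-suc-ℤ n = begin
  + L (suc n)                   ≡⟨ cong +_ (L-suc n) ⟩
  + (2 * F n + F (suc n))       ≡⟨ pos-+ (2 * F n) (F (suc n)) ⟩
  + (2 * F n) ℤ.+ + F (suc n)   ≡⟨ cong (ℤ._+ + F (suc n)) (pos-* 2 (F n)) ⟩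
  + 2 ℤ.* + F n ℤ.+ + F (suc n) ∎
  where open ≡-Reasoning

telescoping-identity : ∀ (N x y z C D : ℤ) → z ≡ y ℤ.+ x → C ≡ + 2 ℤ.* x ℤ.+ y → D ≡ + 2 ℤ.* y ℤ.+ z →
  ((N ℤ.* C ℤ.- y) ℤ.* (C ℤ.* D) ℤ.+ (y ℤ.* z) ℤ.* (+ 5 ℤ.* C)) ℤ.* (+ 5 ℤ.* D)
  ≡ ((+ 1 ℤ.+ N) ℤ.* D ℤ.- z) ℤ.* ((+ 5 ℤ.* C) ℤ.* (C ℤ.* D))
telescoping-identity N x y _ _ _ refl refl refl = polynomial N x y
  where
  polynomial : ∀ N x y →
    ((N ℤ.* (+ 2 ℤ.* x ℤ.+ y) ℤ.- y) ℤ.* ((+ 2 ℤ.* x ℤ.+ y) ℤ.* (+ 2 ℤ.* y ℤ.+ (y ℤ.+ x)))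
      ℤ.+ (y ℤ.* (y ℤ.+ x)) ℤ.* (+ 5 ℤ.* (+ 2 ℤ.* x ℤ.+ y))) ℤ.* (+ 5 ℤ.* (+ 2 ℤ.* y ℤ.+ (y ℤ.+ x)))
    ≡ ((+ 1 ℤ.+ N) ℤ.* (+ 2 ℤ.* y ℤ.+ (y ℤ.+ x)) ℤ.- (y ℤ.+ x))
      ℤ.* ((+ 5 ℤ.* (+ 2 ℤ.* x ℤ.+ y)) ℤ.* ((+ 2 ℤ.* x ℤ.+ y) ℤ.* (+ 2 ℤ.* y ℤ.+ (y ℤ.+ x))))
  polynomial = solve-∀

closedForm : ℕ → ℚ
closedForm n = ((+ (n * L n) ℤ.- + F n) ℚ./ (5 * L n)) {{5*L-nonZero n}}

closedForm-suc : ∀ n → closedForm (suc n) ℚ.+ term (suc n) ≡ closedForm (suc (suc n))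
closedForm-suc n =
  p/q+r/s≡v/t (+ (n₁ * C) ℤ.- + y) (5 * C) (+ (y * z)) (C * D) (+ (n₂ * D) ℤ.- + z) (5 * D)
    {{5*L-nonZero n₁}} {{L*L-nonZero n₁}} {{5*L-nonZero n₂}} (begin
    ((+ (n₁ * C) ℤ.- + y) ℤ.* + (C * D) ℤ.+ + (y * z) ℤ.* + (5 * C)) ℤ.* + (5 * D)
      ≡⟨ cong₂ ℤ._*_ (cong₂ ℤ._+_ (cong₂ ℤ._*_ (cong (ℤ._- + y) (pos-* n₁ C)) (pos-* C D))
                                  (cong₂ ℤ._*_ (pos-* y z) (pos-* 5 C)))
                     (pos-* 5 D) ⟩
    ((+ n₁ ℤ.* + C ℤ.- + y) ℤ.* (+ C ℤ.* + D) ℤ.+ (+ y ℤ.* + z) ℤ.* (+ 5 ℤ.* + C)) ℤ.* (+ 5 ℤ.* + D)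
      ≡⟨ telescoping-identity (+ n₁) (+ F n) (+ y) (+ z) (+ C) (+ D)
           (pos-+ y (F n)) (L-suc-ℤ n) (L-suc-ℤ n₁) ⟩
    ((+ 1 ℤ.+ + n₁) ℤ.* + D ℤ.- + z) ℤ.* ((+ 5 ℤ.* + C) ℤ.* (+ C ℤ.* + D))
      ≡⟨ sym (cong₂ ℤ._*_ (cong (ℤ._- + z) (trans (pos-* n₂ D) (cong (ℤ._* + D) (pos-+ 1 n₁))))
                          (trans (pos-* (5 * C) (C * D)) (cong₂ ℤ._*_ (pos-* 5 C) (pos-* C D)))) ⟩
    (+ (n₂ * D) ℤ.- + z) ℤ.* + (5 * C * (C * D))
  ∎)
  where
  open ≡-Reasoning
  n₁ n₂ y z C D : ℕ
  n₁ = suc n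
  n₂ = suc n₁
  y = F n₁
  z = F n₂
  C = L n₁
  D = L n₂

sumTo≡closedForm : ∀ m → sumTo m ≡ closedForm (suc m)
sumTo≡closedForm zero = refl
sumTo≡closedForm (suc m) = begin
  sumTo m ℚ.+ term (suc m)            ≡⟨ cong (ℚ._+ term (suc m)) (sumTo≡closedForm m) ⟩
  closedForm (suc m) ℚ.+ term (suc m) ≡⟨ closedForm-suc m ⟩
  closedForm (suc (suc m))            ∎
  where open ≡-Reasoning

rhs≡closedForm : ∀ m → rhs m ≡ closedForm (suc m)
rhs≡closedForm m = /-cong {{5*L-nonZero (m + 1)}} {{5*L-nonZero (suc m)}}
  (cong (λ k → + (k * L k) ℤ.- + F k) m+1≡1+m) (cong (λ k → 5 * L k) m+1≡1+m)
  where
  m+1≡1+m : m + 1 ≡ suc m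
  m+1≡1+m = +-comm m 1

propositionA1 : (m : ℕ) → m ≥ 1 → sumTo m ≡ rhs m
propositionA1 m _ = trans (sumTo≡closedForm m) (sym (rhs≡closedForm m))
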